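{- Let $X=\{1,\ldots,n\}$, let $\pi=(x_1,\ldots,x_n)$ be a circular ordering, and let $\delta$ be a dissimilarity map on $X$ satisfying the Kalmanson conditions with respect to $\pi$. Let $\mathcal{C}=\{C_1,\ldots,C_m\}$, $m\ge3$, be a partial circular ordering with a weighting $\mu$, such that whenever $x_a\in C_r$, $x_b\in C_s$ and $r<s$, we have $a<b$. Then for every $i\in\{1,\ldots,m\}$, with block indices taken modulo $m$, \[ Q_\delta(C_i,C_{i+2})-Q_\delta(C_i,C_{i+1})\ge0. \]
   Context: Dissimilarity map: a function $\delta:X\times X\to\mathbb{R}$ with $\delta(i,j)=\delta(j,i)\ge0$ and $\delta(i,i)=0$. Kalmanson conditions with respect to $\pi$: for all $1\le i<j<k<l\le n$, $\delta(x_i,x_j)+\delta(x_k,x_l)\le\delta(x_i,x_k)+\delta(x_j,x_l)$ and $\delta(x_i,x_l)+\delta(x_j,x_k)\le\delta(x_i,x_k)+\delta(x_j,x_l)$. Partial circular ordering: a partition $\{C_1,\ldots,C_m\}$ of $X$ into linearly ordered blocks (paths). $\hat C_r$ denotes the endpoints of $C_r$: the single element if $|C_r|=1$, and the two ends otherwise. Weighting: a function $\mu:X\to\mathbb{R}_{\ge0}$ with $\sum_{i\in C_r}\mu(i)=1$ and $\mu>0$ on $\hat C_r$. One sets $\delta(C_r,C_s)=\sum_{a\in C_r,b\in C_s}\mu(a)\mu(b)\delta(a,b)$ and $Q_\delta(C_r,C_s)=(m-2)\delta(C_r,C_s)-\sum_{t\ne r}\delta(C_r,C_t)-\sum_{t\ne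 s}\delta(C_t,C_s)$. -}

module Defs where

open import Level using (Level; _⊔_) renaming (suc to lsuc)
open import Algebra.Bundles using (CommutativeRing)
open import Relation.Binary.Core using (Rel)
open import Relation.Binary.Structures using (IsTotalOrder)
open import Relation.Nullary using (¬_; does)
open import Data.Bool using (if_then_else_)
open import Data.Nat as ℕ using (ℕ; zero; suc)
open import Data.Nat.DivMod using (m%n<n)
open import Data.Product using (_×_)
open import Data.Fin as Fin using (Fin; toℕ; fromℕ<)
open import Data.List using (List; []; _∷_; foldr; map; head; last; allFin)
open import Data.Maybe using (just)
open import Data.Sum using (_⊎_)
open import Relation.Binary.PropositionalEquality using (_≡_)

-- An ordered commutative ring (the real numbers are one; all the paper's
-- quantities live in ℝ, and the statement only uses ring operations and ≤).
record OrderedCommRing (c ℓ₁ ℓ₂ : Level) : Set (lsuc (c ⊔ ℓ₁ ⊔ ℓ₂)) where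
  field
    commRing : CommutativeRing c ℓ₁
  open CommutativeRing commRing public
  field
    _≤_          : Rel Carrier ℓ₂
    isTotalOrder : IsTotalOrder _≈_ _≤_
    +-mono-≤     : ∀ {x y} z → x ≤ y → (x + z) ≤ (y + z)
    *-nonneg     : ∀ {x y} → 0# ≤ x → 0# ≤ y → 0# ≤ (x * y)

  _<_ : Carrier → Carrier → Set (ℓ₁ ⊔ ℓ₂)
  x < y = (x ≤ y) × (¬ (x ≈ y))

cyc : ∀ {m} → Fin m → ℕ → Fin m
cyc {suc m} i k = fromℕ< (m%n<n (toℕ i ℕ.+ k) (suc m))

Endpoint : ∀ {n} → List (Fin n) → Fin n → Set
Endpoint C x = (head C ≡ just x) ⊎ (last C ≡ just x)

module WithRing {c ℓ₁ ℓ₂} (R : OrderedCommRing c ℓ₁ ℓ₂) where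
  open OrderedCommRing R

  sumL : List Carrier → Carrier
  sumL = foldr _+_ 0#

  _·_ : ℕ → Carrier → Carrier
  zero  · x = 0#
  suc k · x = x + (k · x)

  module Blocks {n m : ℕ} (δ : Fin n → Fin n → Carrier) (μ : Fin n → Carrier)
                (C : Fin m → List (Fin n)) where

    δC : Fin m → Fin m → Carrier
    δC r s = sumL (map (λ a → sumL (map (λ b → (μ a * μ b) * δ a b) (C s))) (C r))

    sumExcept : Fin m → (Fin m → Carrier) → Carrier
    sumExcept r f = sumL (map (λ t → if does (t Fin.≟ r) then 0# else f t) (allFin m))

    Q : Fin m → Fin m → Carrier
    Q r s = (((m ℕ.∸ 2) · δC r s) - sumExcept r (λ t → δC r t)) - sumExcept s (λ t → δC t s)

  record IsDissimilarity {n : ℕ} (δ : Fin n → Fin n → Carrier) : Set (c ⊔ ℓ₁ ⊔ ℓ₂) where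
    field
      symm    : ∀ i j → δ i j ≈ δ j i
      nonneg  : ∀ i j → 0# ≤ δ i j
      diag    : ∀ i → δ i i ≈ 0#

  -- Kalmanson conditions w.r.t. the circular ordering π = (x_1,…,x_n), x_a = π a
  Kalmanson : {n : ℕ} → (Fin n → Fin n) → (Fin n → Fin n → Carrier) → Set (ℓ₂)
  Kalmanson {n} π δ = ∀ (i j k l : Fin n) → i Fin.< j → j Fin.< k → k Fin.< l →
      ((d i j + d k l) ≤ (d i k + d j l)) × ((d i l + d j k) ≤ (d i k + d j l))
    where
      d : Fin n → Fin n → Carrier
      d a b = δ (π a) (π b)

-- Fix three consecutive blocks A, B, C and write e = δC. After the terms Σ_{t≠A} e(A,t) cancel,
-- Q(A,C) - Q(A,B) is a sum over the blocks t ∉ {B,C} of (e(A,C) - e(A,B)) + (e(t,B) - e(t,C)); only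
-- the symmetry of e is needed to match the two cross terms e(C,B) and e(B,C). The summand for t = A
-- vanishes. For any other t the blocks A, B, C, t lie in this cyclic order, hence so do any points
-- a ∈ A, b ∈ B, c ∈ C, d ∈ t with respect to π, and the Kalmanson conditions give the four-point
-- inequality δ(a,b) + δ(c,d) ≤ δ(a,c) + δ(b,d). Averaging it with the weights μ, which form a
-- probability distribution on each block, yields the same inequality for e, i.e. a nonnegative summand.
module Submission where

open import Defs
open import Data.Nat as ℕ using (ℕ; suc; z≤n; s≤s)
open import Data.Fin as Fin using (Fin; toℕ)
open import Data.Fin.Permutation using (Permutation′; _⟨$⟩ʳ_; _⟨$⟩ˡ_; inverseʳ)
open import Data.List using (List; []; _∷_; map; length; concat; tabulate; allFin)
open import Data.List.Membership.Propositional using (_∈_)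
open import Data.List.Relation.Binary.Permutation.Propositional using (_↭_)
open import Relation.Binary.PropositionalEquality using (_≢_)

open import Algebra.Bundles using (CommutativeRing)
open import Algebra.Core using (Op₂)
open import Data.Bool using (if_then_else_)
open import Data.Empty using (⊥-elim)
open import Data.Fin.Properties using (toℕ-fromℕ<; toℕ-injective; toℕ<n)
open import Data.List.Properties using (length-tabulate; map-tabulate)
open import Data.List.Relation.Unary.Any using (here; there)
open import Data.Maybe using (nothing)
open import Data.Nat.DivMod using (_%_; m<n⇒m%n≡m; n%n≡0; [m+n]%n≡m%n)
open import Data.Nat.Properties using (<-cmp; n<1+n; ≤∧≢⇒<; <⇒≢; ≤-pred; ≤-antisym; <-trans)
import Data.Nat.Properties as ℕₚ
open import Data.Product using (proj₁; proj₂)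
open import Function using (_∘_)
open import Relation.Binary.Bundles using (Poset)
open import Relation.Binary.Definitions using (Tri; tri<; tri≈; tri>)
open import Relation.Binary.PropositionalEquality using (_≡_; ≢-sym; module ≡-Reasoning)
import Relation.Binary.PropositionalEquality as ≡
import Relation.Binary.Reasoning.PartialOrder as PosetReasoning
import Relation.Binary.Reasoning.Setoid as SetoidReasoning
open import Relation.Binary.Structures using (IsTotalOrder)
open import Relation.Nullary using (does; yes; no)
open import Tactic.RingSolver using (solve-∀)
open import Tactic.RingSolver.Core.AlmostCommutativeRing
  using (AlmostCommutativeRing; fromCommutativeRing)

private variable
  A B : Set

data Cyclic (_<_ : A → A → Set) (w x y z : A) : Set where
  wxyz : w < x → x < y → y < z → Cyclic _<_ w x y z
  zwxy : z < w → w < x → x < y → Cyclic _<_ w x y z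
  yzwx : y < z → z < w → w < x → Cyclic _<_ w x y z
  xyzw : x < y → y < z → z < w → Cyclic _<_ w x y z

Cyclic-transport : ∀ {_<₁_ : A → A → Set} {_<₂_ : B → B → Set} (_∼_ : A → B → Set) →
  (∀ {x x′ y y′} → x ∼ x′ → y ∼ y′ → x <₁ y → x′ <₂ y′) →
  ∀ {w x y z w′ x′ y′ z′} → w ∼ w′ → x ∼ x′ → y ∼ y′ → z ∼ z′ →
  Cyclic _<₁_ w x y z → Cyclic _<₂_ w′ x′ y′ z′
Cyclic-transport _ mono w∼ x∼ y∼ z∼ (wxyz w<x x<y y<z) =
  wxyz (mono w∼ x∼ w<x) (mono x∼ y∼ x<y) (mono y∼ z∼ y<z)
Cyclic-transport _ mono w∼ x∼ y∼ z∼ (zwxy z<w w<x x<y) =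
  zwxy (mono z∼ w∼ z<w) (mono w∼ x∼ w<x) (mono x∼ y∼ x<y)
Cyclic-transport _ mono w∼ x∼ y∼ z∼ (yzwx y<z z<w w<x) =
  yzwx (mono y∼ z∼ y<z) (mono z∼ w∼ z<w) (mono w∼ x∼ w<x)
Cyclic-transport _ mono w∼ x∼ y∼ z∼ (xyzw x<y y<z z<w) =
  xyzw (mono x∼ y∼ x<y) (mono y∼ z∼ y<z) (mono z∼ w∼ z<w)

data Consecutive₃ (m : ℕ) : ℕ → ℕ → ℕ → Set where
  no-wrap   : ∀ {x} → suc (suc x) ℕ.< m → Consecutive₃ m x (suc x) (suc (suc x))
  wrap-last : ∀ {x} → suc (suc x) ≡ m → Consecutive₃ m x (suc x) 0
  wrap-mid  : ∀ {x} → suc x ≡ m → Consecutive₃ m x 0 1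

Consecutive₃-distinct : ∀ {m x y z} → Consecutive₃ m x y z → y ≢ z
Consecutive₃-distinct (no-wrap _)   = <⇒≢ (n<1+n _)
Consecutive₃-distinct (wrap-last _) = λ ()
Consecutive₃-distinct (wrap-mid _)  = λ ()

Consecutive₃-cyclic : ∀ {m x y z t} → Consecutive₃ m x y z → t ℕ.< m → t ≢ x → t ≢ y → t ≢ z →
                      Cyclic ℕ._<_ x y z t
Consecutive₃-cyclic {x = x} {t = t} (no-wrap _) t<m t≢x t≢y t≢z with <-cmp t x
... | tri< t<x _ _ = zwxy t<x (n<1+n x) (n<1+n (suc x))
... | tri≈ _ t≡x _ = ⊥-elim (t≢x t≡x)
... | tri> _ _ x<t = wxyz (n<1+n x) (n<1+n (suc x)) (≤∧≢⇒< (≤∧≢⇒< x<t (≢-sym t≢y)) (≢-sym t≢z))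
Consecutive₃-cyclic {x = x} (wrap-last ≡.refl) t<m t≢x t≢y t≢z =
  yzwx (≤∧≢⇒< z≤n (≢-sym t≢z)) (≤∧≢⇒< (≤-pred (≤∧≢⇒< (≤-pred t<m) t≢y)) t≢x) (n<1+n x)
Consecutive₃-cyclic (wrap-mid ≡.refl) t<m t≢x t≢y t≢z =
  xyzw (s≤s z≤n) (≤∧≢⇒< (≤∧≢⇒< z≤n (≢-sym t≢y)) (≢-sym t≢z)) (≤∧≢⇒< (≤-pred t<m) t≢x)

cyc-consecutive : ∀ {k} (i : Fin (suc (suc k))) →
                  Consecutive₃ (suc (suc k)) (toℕ i) (toℕ (cyc i 1)) (toℕ (cyc i 2))
cyc-consecutive {k} i =
  ≡.subst₂ (Consecutive₃ m x) (≡.sym (toℕ-fromℕ< _)) (≡.sym (toℕ-fromℕ< _))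
    (by-cases (<-cmp (suc (suc x)) m))
  where
  m = suc (suc k)
  x = toℕ i

  %-small : ∀ j → j ℕ.+ x ℕ.< m → (x ℕ.+ j) % m ≡ j ℕ.+ x
  %-small j j+x<m = ≡.trans (≡.cong (_% m) (ℕₚ.+-comm x j)) (m<n⇒m%n≡m j+x<m)

  %-wrap : ∀ j → j ℕ.+ x ≡ m → (x ℕ.+ j) % m ≡ 0
  %-wrap j j+x≡m = ≡.trans (≡.cong (_% m) (≡.trans (ℕₚ.+-comm x j) j+x≡m)) (n%n≡0 m)

  by-cases : Tri (suc (suc x) ℕ.< m) (suc (suc x) ≡ m) (m ℕ.< suc (suc x)) →
             Consecutive₃ m x ((x ℕ.+ 1) % m) ((x ℕ.+ 2) % m)
  by-cases (tri< 2+x<m _ _) =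
    ≡.subst₂ (Consecutive₃ m x) (≡.sym (%-small 1 (<-trans (n<1+n _) 2+x<m))) (≡.sym (%-small 2 2+x<m))
      (no-wrap 2+x<m)
  by-cases (tri≈ _ 2+x≡m _) =
    ≡.subst₂ (Consecutive₃ m x) (≡.sym (%-small 1 (ℕₚ.≤-reflexive 2+x≡m))) (≡.sym (%-wrap 2 2+x≡m))
      (wrap-last 2+x≡m)
  by-cases (tri> _ _ m<2+x) =
    ≡.subst₂ (Consecutive₃ m x) (≡.sym (%-wrap 1 1+x≡m)) (≡.sym x+2%m≡1) (wrap-mid 1+x≡m)
    where
    1+x≡m : suc x ≡ m
    1+x≡m = ≤-antisym (toℕ<n i) (≤-pred m<2+x)

    x+2%m≡1 : (x ℕ.+ 2) % m ≡ 1
    x+2%m≡1 = begin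
      (x ℕ.+ 2) % m  ≡⟨ ≡.cong (_% m) (≡.trans (ℕₚ.+-comm x 2) (≡.cong suc 1+x≡m)) ⟩
      (1 ℕ.+ m) % m  ≡⟨ [m+n]%n≡m%n 1 m ⟩
      1 % m          ≡⟨ m<n⇒m%n≡m (s≤s (s≤s (z≤n {k}))) ⟩
      1              ∎
      where open ≡-Reasoning

cyc-distinct : ∀ {k} (i : Fin (suc (suc k))) → cyc i 1 ≢ cyc i 2
cyc-distinct i = Consecutive₃-distinct (cyc-consecutive i) ∘ ≡.cong toℕ

cyc-cyclic : ∀ {k} (i t : Fin (suc (suc k))) → t ≢ i → t ≢ cyc i 1 → t ≢ cyc i 2 →
             Cyclic Fin._<_ i (cyc i 1) (cyc i 2) t
cyc-cyclic i t t≢i t≢j t≢l =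
  Cyclic-transport (λ x r → x ≡ toℕ r) (λ { ≡.refl ≡.refl x<y → x<y }) ≡.refl ≡.refl ≡.refl ≡.refl
    (Consecutive₃-cyclic (cyc-consecutive i) (toℕ<n t)
       (t≢i ∘ toℕ-injective) (t≢j ∘ toℕ-injective) (t≢l ∘ toℕ-injective))

-- Rearrangements that need no cancellation: over an abstract ring the reflective solver cannot
-- decide that a coefficient such as 1 - 1 vanishes, so identities like x - x ≈ 0 are out of its reach.
module CancellationFree {c ℓ} (R : CommutativeRing c ℓ) where
  ring⋆ : AlmostCommutativeRing c ℓ
  ring⋆ = fromCommutativeRing R (λ _ → nothing)
  open AlmostCommutativeRing ring⋆

  [a-b]+[c-d]≈[a+c]-[b+d] : ∀ a b c d → (a - b) + (c - d) ≈ (a + c) - (b + d)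
  [a-b]+[c-d]≈[a+c]-[b+d] = solve-∀ ring⋆

  [p-s-u]+[v+[s′-q]]≈[p-q]+[v-u]+[s′-s] : ∀ p q s s′ u v →
    ((p - s) - u) + (v + (s′ - q)) ≈ ((p - q) + (v - u)) + (s′ - s)
  [p-s-u]+[v+[s′-q]]≈[p-q]+[v-u]+[s′-s] = solve-∀ ring⋆

  [a+x]-[a′+y]≈[x-y]+[a-a′] : ∀ a a′ x y → (a + x) - (a′ + y) ≈ (x - y) + (a - a′)
  [a+x]-[a′+y]≈[x-y]+[a-a′] = solve-∀ ring⋆

module _ {c ℓ₁ ℓ₂} (R : OrderedCommRing c ℓ₁ ℓ₂) where
  open OrderedCommRing R
  open WithRing R
  open IsTotalOrder isTotalOrder using (≲-respˡ-≈; ≲-respʳ-≈)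
    renaming (refl to ≤-refl; trans to ≤-trans; reflexive to ≤-reflexive)
  open import Algebra.Properties.Ring ring using (-0#≈0#; +-cancelˡ; -‿distribʳ-*; ⁻¹-anti-homo‿-)
  open import Algebra.Properties.CommutativeSemigroup +-commutativeSemigroup
    using (interchange; x∙yz≈y∙xz)
  open import Algebra.Properties.CommutativeSemigroup *-commutativeSemigroup using ()
    renaming (x∙yz≈y∙xz to *-x∙yz≈y∙xz)
  module ≈-Reasoning = SetoidReasoning setoid

  open CancellationFree commRing

  x≈y⇒z+[x-y]≈z : ∀ {x y} z → x ≈ y → z + (x - y) ≈ z
  x≈y⇒z+[x-y]≈z {x} {y} z x≈y = begin
    z + (x - y)  ≈⟨ +-congˡ (+-congˡ (-‿cong (sym x≈y))) ⟩
    z + (x - x)  ≈⟨ +-congˡ (-‿inverseʳ x) ⟩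
    z + 0#       ≈⟨ +-identityʳ z ⟩
    z            ∎
    where open ≈-Reasoning

  [p-s-u]-[q-s-v]≈[p-q]+[v-u] : ∀ p q s u v → ((p - s) - u) - ((q - s) - v) ≈ (p - q) + (v - u)
  [p-s-u]-[q-s-v]≈[p-q]+[v-u] p q s u v = begin
    ((p - s) - u) - ((q - s) - v)       ≈⟨ +-congˡ (⁻¹-anti-homo‿- (q - s) v) ⟩
    ((p - s) - u) + (v - (q - s))       ≈⟨ +-congˡ (+-congˡ (⁻¹-anti-homo‿- q s)) ⟩
    ((p - s) - u) + (v + (s - q))       ≈⟨ [p-s-u]+[v+[s′-q]]≈[p-q]+[v-u]+[s′-s] p q s s u v ⟩
    ((p - q) + (v - u)) + (s - s)       ≈⟨ x≈y⇒z+[x-y]≈z _ refl ⟩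
    (p - q) + (v - u)                   ∎
    where open ≈-Reasoning

  0≈0-0 : 0# ≈ 0# - 0#
  0≈0-0 = sym (trans (+-congˡ -0#≈0#) (+-identityʳ 0#))

  +-mono₂-≤ : ∀ {x y u v} → x ≤ y → u ≤ v → (x + u) ≤ (y + v)
  +-mono₂-≤ {x} {y} {u} {v} x≤y u≤v =
    ≤-trans (+-mono-≤ u x≤y) (≲-respˡ-≈ (+-comm u y) (≲-respʳ-≈ (+-comm v y) (+-mono-≤ y u≤v)))

  x≤y⇒0≤y-x : ∀ {x y} → x ≤ y → 0# ≤ (y - x)
  x≤y⇒0≤y-x {x} x≤y = ≲-respˡ-≈ (-‿inverseʳ x) (+-mono-≤ (- x) x≤y)

  0≤y-x⇒x≤y : ∀ {x y} → 0# ≤ (y - x) → x ≤ y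
  0≤y-x⇒x≤y {x} {y} 0≤y-x = ≲-respˡ-≈ (+-identityˡ x) (≲-respʳ-≈ y-x+x≈y (+-mono-≤ x 0≤y-x))
    where
    y-x+x≈y : (y - x) + x ≈ y
    y-x+x≈y = trans (+-assoc y (- x) x) (trans (+-congˡ (-‿inverseˡ x)) (+-identityʳ y))

  *-monoˡ-≤-nonneg : ∀ {z x y} → 0# ≤ z → x ≤ y → (z * x) ≤ (z * y)
  *-monoˡ-≤-nonneg {z} {x} {y} 0≤z x≤y =
    0≤y-x⇒x≤y (≲-respʳ-≈ z[y-x]≈zy-zx (*-nonneg 0≤z (x≤y⇒0≤y-x x≤y)))
    where
    z[y-x]≈zy-zx : z * (y - x) ≈ z * y - z * x
    z[y-x]≈zy-zx = trans (distribˡ z y (- x)) (+-congˡ (sym (-‿distribʳ-* z x)))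

  ·-distrib-- : ∀ k x y → k · (x - y) ≈ k · x - k · y
  ·-distrib-- ℕ.zero x y = 0≈0-0
  ·-distrib-- (ℕ.suc k) x y =
    trans (+-congˡ (·-distrib-- k x y)) ([a-b]+[c-d]≈[a+c]-[b+d] x y (k · x) (k · y))

  poset : Poset c ℓ₁ ℓ₂
  poset = record { isPartialOrder = IsTotalOrder.isPartialOrder isTotalOrder }

  module ≤-Reasoning = PosetReasoning poset

  ∑ : List A → (A → Carrier) → Carrier
  ∑ xs f = sumL (map f xs)

  syntax ∑ xs (λ x → e) = ∑[ x ∈ xs ] e


  ∑-cong : ∀ (xs : List A) {f g : A → Carrier} → (∀ x → f x ≈ g x) → ∑ xs f ≈ ∑ xs g
  ∑-cong []       f≈g = refl
  ∑-cong (x ∷ xs) f≈g = +-cong (f≈g x) (∑-cong xs f≈g)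

  ∑-mono : ∀ (xs : List A) {f g : A → Carrier} → (∀ {x} → x ∈ xs → f x ≤ g x) → ∑ xs f ≤ ∑ xs g
  ∑-mono []       f≤g = ≤-refl
  ∑-mono (x ∷ xs) f≤g = +-mono₂-≤ (f≤g (here ≡.refl)) (∑-mono xs (λ x∈xs → f≤g (there x∈xs)))

  ∑-const : ∀ (xs : List A) k → ∑[ x ∈ xs ] k ≈ length xs · k
  ∑-const []       k = refl
  ∑-const (x ∷ xs) k = +-congˡ (∑-const xs k)

  ∑-zero : ∀ (ys : List B) → ∑[ y ∈ ys ] 0# ≈ 0#
  ∑-zero []       = refl
  ∑-zero (y ∷ ys) = trans (+-identityˡ _) (∑-zero ys)

  ∑-nonneg : ∀ (xs : List A) {f : A → Carrier} → (∀ x → 0# ≤ f x) → 0# ≤ ∑ xs f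
  ∑-nonneg []       0≤f = ≤-refl
  ∑-nonneg (x ∷ xs) 0≤f = ≲-respˡ-≈ (+-identityʳ 0#) (+-mono₂-≤ (0≤f x) (∑-nonneg xs 0≤f))

  ∑-distrib-+ : ∀ (xs : List A) (f g : A → Carrier) → ∑[ x ∈ xs ] (f x + g x) ≈ ∑ xs f + ∑ xs g
  ∑-distrib-+ []       f g = sym (+-identityʳ 0#)
  ∑-distrib-+ (x ∷ xs) f g =
    trans (+-congˡ (∑-distrib-+ xs f g)) (interchange (f x) (g x) (∑ xs f) (∑ xs g))

  ∑-distrib-- : ∀ (xs : List A) (f g : A → Carrier) → ∑[ x ∈ xs ] (f x - g x) ≈ ∑ xs f - ∑ xs g
  ∑-distrib-- []       f g = 0≈0-0
  ∑-distrib-- (x ∷ xs) f g =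
    trans (+-congˡ (∑-distrib-- xs f g)) ([a-b]+[c-d]≈[a+c]-[b+d] (f x) (g x) (∑ xs f) (∑ xs g))

  ∑-distribˡ-* : ∀ (xs : List A) k (f : A → Carrier) → ∑[ x ∈ xs ] (k * f x) ≈ k * ∑ xs f
  ∑-distribˡ-* []       k f = sym (zeroʳ k)
  ∑-distribˡ-* (x ∷ xs) k f = trans (+-congˡ (∑-distribˡ-* xs k f)) (sym (distribˡ k (f x) (∑ xs f)))

  ∑-comm : ∀ (xs : List A) (ys : List B) (f : A → B → Carrier) →
           ∑[ x ∈ xs ] ∑[ y ∈ ys ] f x y ≈ ∑[ y ∈ ys ] ∑[ x ∈ xs ] f x y
  ∑-comm []       ys f = sym (∑-zero ys)
  ∑-comm (x ∷ xs) ys f =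
    trans (+-congˡ (∑-comm xs ys f)) (sym (∑-distrib-+ ys (f x) (λ y → ∑[ x ∈ xs ] f x y)))

  -- Blocks.sumExcept r f unfolds to ∑[ t ∈ allFin m ] zeroAt r f t.
  zeroAt : ∀ {m} → Fin m → (Fin m → Carrier) → Fin m → Carrier
  zeroAt r f t = if does (t Fin.≟ r) then 0# else f t

  module _ {m} {r : Fin m} where

    zeroAt-≢ : ∀ (f : Fin m → Carrier) {t} → t ≢ r → zeroAt r f t ≈ f t
    zeroAt-≢ f {t} t≢r with t Fin.≟ r
    ... | yes t≡r = ⊥-elim (t≢r t≡r)
    ... | no  _   = refl

    zeroAt-nonneg : ∀ (f : Fin m → Carrier) t → (t ≢ r → 0# ≤ f t) → 0# ≤ zeroAt r f t
    zeroAt-nonneg f t 0≤f with t Fin.≟ r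
    ... | yes _   = ≤-refl
    ... | no  t≢r = 0≤f t≢r

    zeroAt-cong : ∀ {f g : Fin m → Carrier} → (∀ t → f t ≈ g t) → ∀ t → zeroAt r f t ≈ zeroAt r g t
    zeroAt-cong f≈g t with t Fin.≟ r
    ... | yes _ = refl
    ... | no  _ = f≈g t

    zeroAt-zipWith : ∀ (_∙_ : Op₂ Carrier) → (0# ∙ 0#) ≈ 0# → ∀ (f g : Fin m → Carrier) t →
                     zeroAt r (λ u → f u ∙ g u) t ≈ (zeroAt r f t ∙ zeroAt r g t)
    zeroAt-zipWith _∙_ 0∙0≈0 f g t with t Fin.≟ r
    ... | yes _ = sym 0∙0≈0
    ... | no  _ = refl

  zeroAt-comm : ∀ {m} (r s : Fin m) (f : Fin m → Carrier) t →
                zeroAt r (zeroAt s f) t ≈ zeroAt s (zeroAt r f) t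
  zeroAt-comm r s f t with t Fin.≟ r | t Fin.≟ s
  ... | yes _ | yes _ = refl
  ... | yes _ | no  _ = refl
  ... | no  _ | yes _ = refl
  ... | no  _ | no  _ = refl

  ∑-allFin-suc : ∀ {m} (f : Fin (ℕ.suc m) → Carrier) →
                 ∑[ t ∈ allFin (ℕ.suc m) ] f t ≡ f Fin.zero + ∑[ t ∈ allFin m ] f (Fin.suc t)
  ∑-allFin-suc f = ≡.cong (λ ts → f Fin.zero + sumL ts)
                     (≡.trans (map-tabulate Fin.suc f) (≡.sym (map-tabulate (λ t → t) (f ∘ Fin.suc))))

  ∑-zeroAt : ∀ {m} (r : Fin m) (f : Fin m → Carrier) →
             f r + ∑[ t ∈ allFin m ] zeroAt r f t ≈ ∑[ t ∈ allFin m ] f t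
  ∑-zeroAt Fin.zero f = begin
    f Fin.zero + ∑[ t ∈ allFin _ ] zeroAt Fin.zero f t
      ≡⟨ ≡.cong (f Fin.zero +_) (∑-allFin-suc (zeroAt Fin.zero f)) ⟩
    f Fin.zero + (0# + ∑[ t ∈ allFin _ ] f (Fin.suc t))
      ≈⟨ +-congˡ (+-identityˡ _) ⟩
    f Fin.zero + ∑[ t ∈ allFin _ ] f (Fin.suc t)
      ≡⟨ ≡.sym (∑-allFin-suc f) ⟩
    ∑[ t ∈ allFin _ ] f t ∎
    where open ≈-Reasoning
  ∑-zeroAt (Fin.suc r) f = begin
    f (Fin.suc r) + ∑[ t ∈ allFin _ ] zeroAt (Fin.suc r) f t
      ≡⟨ ≡.cong (f (Fin.suc r) +_) (∑-allFin-suc (zeroAt (Fin.suc r) f)) ⟩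
    f (Fin.suc r) + (f Fin.zero + ∑[ t ∈ allFin _ ] zeroAt r (f ∘ Fin.suc) t)
      ≈⟨ x∙yz≈y∙xz (f (Fin.suc r)) (f Fin.zero) _ ⟩
    f Fin.zero + (f (Fin.suc r) + ∑[ t ∈ allFin _ ] zeroAt r (f ∘ Fin.suc) t)
      ≈⟨ +-congˡ (∑-zeroAt r (f ∘ Fin.suc)) ⟩
    f Fin.zero + ∑[ t ∈ allFin _ ] f (Fin.suc t)
      ≡⟨ ≡.sym (∑-allFin-suc f) ⟩
    ∑[ t ∈ allFin _ ] f t ∎
    where open ≈-Reasoning

  ∑-allFin-const : ∀ m x → ∑[ t ∈ allFin m ] x ≈ m · x
  ∑-allFin-const m x =
    trans (∑-const (allFin m) x) (reflexive (≡.cong (_· x) (length-tabulate {n = m} (λ t → t))))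

  sumExcept₂ : ∀ {m} → Fin m → Fin m → (Fin m → Carrier) → Carrier
  sumExcept₂ r s f = ∑[ t ∈ allFin _ ] zeroAt s (zeroAt r f) t

  module _ {m} {r s : Fin m} where

    ∑-zeroAt-split : ∀ (f : Fin m → Carrier) → s ≢ r →
                     ∑[ t ∈ allFin m ] zeroAt r f t ≈ f s + sumExcept₂ r s f
    ∑-zeroAt-split f s≢r = begin
      ∑[ t ∈ allFin m ] zeroAt r f t           ≈⟨ ∑-zeroAt s (zeroAt r f) ⟨
      zeroAt r f s + sumExcept₂ r s f        ≈⟨ +-congʳ (zeroAt-≢ f s≢r) ⟩
      f s + sumExcept₂ r s f                 ∎
      where open ≈-Reasoning

    sumExcept₂-comm : ∀ (f : Fin m → Carrier) → sumExcept₂ r s f ≈ sumExcept₂ s r f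
    sumExcept₂-comm f = ∑-cong (allFin m) (zeroAt-comm s r f)

    sumExcept₂-nonneg : ∀ (f : Fin m → Carrier) → (∀ t → t ≢ r → t ≢ s → 0# ≤ f t) →
                        0# ≤ sumExcept₂ r s f
    sumExcept₂-nonneg f 0≤f = ∑-nonneg (allFin m) (λ t →
      zeroAt-nonneg {r = s} (zeroAt r f) t (λ t≢s → zeroAt-nonneg {r = r} f t (λ t≢r → 0≤f t t≢r t≢s)))

    private
      zeroAt₂-zipWith : ∀ (_∙_ : Op₂ Carrier) → (0# ∙ 0#) ≈ 0# → ∀ (f g : Fin m → Carrier) t →
        zeroAt s (zeroAt r (λ u → f u ∙ g u)) t ≈ (zeroAt s (zeroAt r f) t ∙ zeroAt s (zeroAt r g) t)
      zeroAt₂-zipWith _∙_ 0∙0≈0 f g t =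
        trans (zeroAt-cong {r = s} (zeroAt-zipWith {r = r} _∙_ 0∙0≈0 f g) t)
              (zeroAt-zipWith {r = s} _∙_ 0∙0≈0 (zeroAt r f) (zeroAt r g) t)

    sumExcept₂-+ : ∀ (f g : Fin m → Carrier) →
                   sumExcept₂ r s (λ t → f t + g t) ≈ sumExcept₂ r s f + sumExcept₂ r s g
    sumExcept₂-+ f g = trans (∑-cong (allFin m) (zeroAt₂-zipWith _+_ (+-identityʳ 0#) f g))
                             (∑-distrib-+ (allFin m) _ _)

    sumExcept₂-- : ∀ (f g : Fin m → Carrier) →
                   sumExcept₂ r s (λ t → f t - g t) ≈ sumExcept₂ r s f - sumExcept₂ r s g
    sumExcept₂-- f g = trans (∑-cong (allFin m) (zeroAt₂-zipWith _-_ (sym 0≈0-0) f g))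
                             (∑-distrib-- (allFin m) _ _)

  sumExcept₂-const : ∀ {k} {r s : Fin (ℕ.suc (ℕ.suc k))} → r ≢ s → ∀ x → sumExcept₂ r s (λ _ → x) ≈ k · x
  sumExcept₂-const {k} {r} {s} r≢s x = +-cancelˡ x _ _ (+-cancelˡ x _ _ (begin
    x + (x + sumExcept₂ r s (λ _ → x))
      ≈⟨ +-congˡ (∑-zeroAt-split {r = r} (λ _ → x) (r≢s ∘ ≡.sym)) ⟨
    x + ∑[ t ∈ allFin m ] zeroAt r (λ _ → x) t
      ≈⟨ ∑-zeroAt r (λ _ → x) ⟩
    ∑[ t ∈ allFin m ] x
      ≈⟨ ∑-allFin-const m x ⟩
    x + (x + k · x) ∎))
    where
    open ≈-Reasoning
    m = ℕ.suc (ℕ.suc k)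

  ∑-zeroAt-diff : ∀ {m} {r s : Fin m} (f g : Fin m → Carrier) → r ≢ s → f s ≈ g r →
    ∑[ t ∈ allFin m ] zeroAt r f t - ∑[ t ∈ allFin m ] zeroAt s g t ≈ sumExcept₂ r s (λ t → f t - g t)
  ∑-zeroAt-diff {m} {r} {s} f g r≢s fs≈gr = begin
    ∑[ t ∈ allFin m ] zeroAt r f t - ∑[ t ∈ allFin m ] zeroAt s g t
      ≈⟨ +-cong (∑-zeroAt-split f (r≢s ∘ ≡.sym)) (-‿cong (∑-zeroAt-split g r≢s)) ⟩
    (f s + sumExcept₂ r s f) - (g r + sumExcept₂ s r g)
      ≈⟨ [a+x]-[a′+y]≈[x-y]+[a-a′] (f s) (g r) _ _ ⟩
    (sumExcept₂ r s f - sumExcept₂ s r g) + (f s - g r)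
      ≈⟨ x≈y⇒z+[x-y]≈z _ fs≈gr ⟩
    sumExcept₂ r s f - sumExcept₂ s r g
      ≈⟨ +-congˡ (-‿cong (sumExcept₂-comm g)) ⟩
    sumExcept₂ r s f - sumExcept₂ r s g
      ≈⟨ sumExcept₂-- f g ⟨
    sumExcept₂ r s (λ t → f t - g t) ∎
    where open ≈-Reasoning

  FourPoint : (A → A → Carrier) → A → A → A → A → Set ℓ₂
  FourPoint δ a b c d = (δ a b + δ c d) ≤ (δ a c + δ b d)

  FourPoint-cong : ∀ {δ δ′ : A → A → Carrier} → (∀ x y → δ x y ≈ δ′ x y) →
                   ∀ {a b c d} → FourPoint δ a b c d → FourPoint δ′ a b c d
  FourPoint-cong δ≈δ′ =
    ≲-respˡ-≈ (+-cong (δ≈δ′ _ _) (δ≈δ′ _ _)) ∘ ≲-respʳ-≈ (+-cong (δ≈δ′ _ _) (δ≈δ′ _ _))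

  FourPoint⇒0≤[ac-ab]+[db-dc] : ∀ {δ : A → A → Carrier} → (∀ x y → δ x y ≈ δ y x) →
    ∀ {a b c d} → FourPoint δ a b c d → 0# ≤ ((δ a c - δ a b) + (δ d b - δ d c))
  FourPoint⇒0≤[ac-ab]+[db-dc] {δ = δ} δ-sym {a} {b} {c} {d} four-point =
    ≲-respʳ-≈ (sym ([a-b]+[c-d]≈[a+c]-[b+d] (δ a c) (δ a b) (δ d b) (δ d c)))
      (x≤y⇒0≤y-x (≲-respˡ-≈ (+-congˡ (δ-sym c d)) (≲-respʳ-≈ (+-congˡ (δ-sym b d)) four-point)))

  kalmanson-cyclic : ∀ {n} {f : Fin n → Fin n} {δ : Fin n → Fin n → Carrier} →
    Kalmanson f δ → (∀ x y → δ x y ≈ δ y x) →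
    ∀ {i j k l a b c d} → Cyclic Fin._<_ i j k l → f i ≡ a → f j ≡ b → f k ≡ c → f l ≡ d →
    FourPoint δ a b c d
  kalmanson-cyclic K δ-sym (wxyz i<j j<k k<l) ≡.refl ≡.refl ≡.refl ≡.refl = proj₁ (K _ _ _ _ i<j j<k k<l)
  kalmanson-cyclic K δ-sym (zwxy l<i i<j j<k) ≡.refl ≡.refl ≡.refl ≡.refl =
    ≲-respˡ-≈ (trans (+-comm _ _) (+-congˡ (δ-sym _ _)))
      (≲-respʳ-≈ (trans (+-comm _ _) (+-congˡ (δ-sym _ _))) (proj₂ (K _ _ _ _ l<i i<j j<k)))
  kalmanson-cyclic K δ-sym (yzwx k<l l<i i<j) ≡.refl ≡.refl ≡.refl ≡.refl =
    ≲-respˡ-≈ (+-comm _ _) (≲-respʳ-≈ (+-cong (δ-sym _ _) (δ-sym _ _)) (proj₁ (K _ _ _ _ k<l l<i i<j)))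
  kalmanson-cyclic K δ-sym (xyzw j<k k<l l<i) ≡.refl ≡.refl ≡.refl ≡.refl =
    ≲-respˡ-≈ (+-congʳ (δ-sym _ _))
      (≲-respʳ-≈ (trans (+-comm _ _) (+-congʳ (δ-sym _ _))) (proj₂ (K _ _ _ _ j<k k<l l<i)))

  module Expectation (μ : A → Carrier) where

    𝔼 : List A → (A → Carrier) → Carrier
    𝔼 xs f = ∑[ x ∈ xs ] (μ x * f x)

    syntax 𝔼 xs (λ x → e) = 𝔼[ x ∈ xs ] e

    𝔼-cong : ∀ xs {f g : A → Carrier} → (∀ x → f x ≈ g x) → 𝔼 xs f ≈ 𝔼 xs g
    𝔼-cong xs f≈g = ∑-cong xs (λ x → *-congˡ (f≈g x))

    𝔼-const : ∀ xs → ∑ xs μ ≈ 1# → ∀ k → 𝔼[ x ∈ xs ] k ≈ k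
    𝔼-const xs ∑μ≈1 k = begin
      ∑[ x ∈ xs ] (μ x * k) ≈⟨ ∑-cong xs (λ x → *-comm (μ x) k) ⟩
      ∑[ x ∈ xs ] (k * μ x) ≈⟨ ∑-distribˡ-* xs k μ ⟩
      k * ∑ xs μ            ≈⟨ *-congˡ ∑μ≈1 ⟩
      k * 1#                ≈⟨ *-identityʳ k ⟩
      k                     ∎
      where open ≈-Reasoning

    𝔼-distrib-+ : ∀ xs (f g : A → Carrier) → 𝔼[ x ∈ xs ] (f x + g x) ≈ 𝔼 xs f + 𝔼 xs g
    𝔼-distrib-+ xs f g = trans (∑-cong xs (λ x → distribˡ (μ x) (f x) (g x))) (∑-distrib-+ xs _ _)

    𝔼-comm : ∀ (xs ys : List A) (f : A → A → Carrier) →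
             𝔼[ x ∈ xs ] 𝔼[ y ∈ ys ] f x y ≈ 𝔼[ y ∈ ys ] 𝔼[ x ∈ xs ] f x y
    𝔼-comm xs ys f = begin
      𝔼[ x ∈ xs ] 𝔼[ y ∈ ys ] f x y
        ≈⟨ ∑-cong xs (λ x → ∑-distribˡ-* ys (μ x) _) ⟨
      ∑[ x ∈ xs ] ∑[ y ∈ ys ] (μ x * (μ y * f x y))
        ≈⟨ ∑-comm xs ys _ ⟩
      ∑[ y ∈ ys ] ∑[ x ∈ xs ] (μ x * (μ y * f x y))
        ≈⟨ ∑-cong ys (λ y → ∑-cong xs (λ x → *-x∙yz≈y∙xz (μ x) (μ y) _)) ⟩
      ∑[ y ∈ ys ] ∑[ x ∈ xs ] (μ y * (μ x * f x y))
        ≈⟨ ∑-cong ys (λ y → ∑-distribˡ-* xs (μ y) _) ⟩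
      𝔼[ y ∈ ys ] 𝔼[ x ∈ xs ] f x y ∎
      where open ≈-Reasoning

    module _ (0≤μ : ∀ x → 0# ≤ μ x) where

      𝔼-mono : ∀ xs {f g : A → Carrier} → (∀ {x} → x ∈ xs → f x ≤ g x) → 𝔼 xs f ≤ 𝔼 xs g
      𝔼-mono xs f≤g = ∑-mono xs (λ x∈xs → *-monoˡ-≤-nonneg (0≤μ _) (f≤g x∈xs))

      𝔼-four-point : ∀ (δ : A → A → Carrier) {P Q R S} →
        ∑ P μ ≈ 1# → ∑ Q μ ≈ 1# → ∑ R μ ≈ 1# → ∑ S μ ≈ 1# →
        (∀ {a b c d} → a ∈ P → b ∈ Q → c ∈ R → d ∈ S → FourPoint δ a b c d) →
        FourPoint (λ X Y → 𝔼[ x ∈ X ] 𝔼[ y ∈ Y ] δ x y) P Q R S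
      𝔼-four-point δ {P} {Q} {R} {S} ∑P ∑Q ∑R ∑S four-point = begin
        𝔼[ a ∈ P ] 𝔼[ b ∈ Q ] δ a b + 𝔼[ c ∈ R ] 𝔼[ d ∈ S ] δ c d
          ≈⟨ +-cong ab cd ⟨
        𝔼⁴ (λ a b c d → δ a b) + 𝔼⁴ (λ a b c d → δ c d)
          ≈⟨ 𝔼⁴-distrib-+ (λ a b c d → δ a b) (λ a b c d → δ c d) ⟨
        𝔼⁴ (λ a b c d → δ a b + δ c d)
          ≤⟨ 𝔼-mono P (λ a∈P → 𝔼-mono Q (λ b∈Q → 𝔼-mono R (λ c∈R → 𝔼-mono S (λ d∈S →
               four-point a∈P b∈Q c∈R d∈S)))) ⟩
        𝔼⁴ (λ a b c d → δ a c + δ b d)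
          ≈⟨ 𝔼⁴-distrib-+ (λ a b c d → δ a c) (λ a b c d → δ b d) ⟩
        𝔼⁴ (λ a b c d → δ a c) + 𝔼⁴ (λ a b c d → δ b d)
          ≈⟨ +-cong ac bd ⟩
        𝔼[ a ∈ P ] 𝔼[ c ∈ R ] δ a c + 𝔼[ b ∈ Q ] 𝔼[ d ∈ S ] δ b d ∎
        where
        open ≤-Reasoning

        𝔼⁴ : (A → A → A → A → Carrier) → Carrier
        𝔼⁴ F = 𝔼[ a ∈ P ] 𝔼[ b ∈ Q ] 𝔼[ c ∈ R ] 𝔼[ d ∈ S ] F a b c d

        𝔼⁴-distrib-+ : ∀ F G → 𝔼⁴ (λ a b c d → F a b c d + G a b c d) ≈ 𝔼⁴ F + 𝔼⁴ G
        𝔼⁴-distrib-+ F G = trans (𝔼-cong P λ a → trans (𝔼-cong Q λ b → trans (𝔼-cong R λ c →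
          𝔼-distrib-+ S _ _) (𝔼-distrib-+ R _ _)) (𝔼-distrib-+ Q _ _)) (𝔼-distrib-+ P _ _)

        ab : 𝔼⁴ (λ a b c d → δ a b) ≈ 𝔼[ a ∈ P ] 𝔼[ b ∈ Q ] δ a b
        ab = 𝔼-cong P λ a → 𝔼-cong Q λ b → trans (𝔼-cong R λ c → 𝔼-const S ∑S _) (𝔼-const R ∑R _)

        cd : 𝔼⁴ (λ a b c d → δ c d) ≈ 𝔼[ c ∈ R ] 𝔼[ d ∈ S ] δ c d
        cd = trans (𝔼-cong P λ a → 𝔼-const Q ∑Q _) (𝔼-const P ∑P _)

        ac : 𝔼⁴ (λ a b c d → δ a c) ≈ 𝔼[ a ∈ P ] 𝔼[ c ∈ R ] δ a c
        ac = 𝔼-cong P λ a → trans (𝔼-cong Q λ b → 𝔼-cong R λ c → 𝔼-const S ∑S _) (𝔼-const Q ∑Q _)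

        bd : 𝔼⁴ (λ a b c d → δ b d) ≈ 𝔼[ b ∈ Q ] 𝔼[ d ∈ S ] δ b d
        bd = trans (𝔼-cong P λ a → 𝔼-cong Q λ b → 𝔼-const R ∑R _) (𝔼-const P ∑P _)

  module _ {n m} (δ : Fin n → Fin n → Carrier) (μ : Fin n → Carrier) (C : Fin m → List (Fin n)) where
    open Blocks δ μ C
    open Expectation μ

    δC≈𝔼 : ∀ r s → δC r s ≈ 𝔼[ a ∈ C r ] 𝔼[ b ∈ C s ] δ a b
    δC≈𝔼 r s = ∑-cong (C r) λ a →
      trans (∑-cong (C s) λ b → *-assoc (μ a) (μ b) (δ a b)) (∑-distribˡ-* (C s) (μ a) _)

    δC-sym : (∀ x y → δ x y ≈ δ y x) → ∀ r s → δC r s ≈ δC s r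
    δC-sym δ-sym r s = begin
      δC r s                             ≈⟨ δC≈𝔼 r s ⟩
      𝔼[ a ∈ C r ] 𝔼[ b ∈ C s ] δ a b    ≈⟨ 𝔼-comm (C r) (C s) δ ⟩
      𝔼[ b ∈ C s ] 𝔼[ a ∈ C r ] δ a b    ≈⟨ 𝔼-cong (C s) (λ b → 𝔼-cong (C r) (λ a → δ-sym a b)) ⟩
      𝔼[ b ∈ C s ] 𝔼[ a ∈ C r ] δ b a    ≈⟨ δC≈𝔼 s r ⟨
      δC s r                             ∎
      where open ≈-Reasoning

  module _ {n k} (δ : Fin n → Fin n → Carrier) (μ : Fin n → Carrier)
           (C : Fin (ℕ.suc (ℕ.suc k)) → List (Fin n)) where
    open Blocks δ μ C

    Q-difference : ∀ {r s u} → s ≢ u → δC u s ≈ δC s u →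
      Q r u - Q r s ≈ sumExcept₂ s u (λ t → (δC r u - δC r s) + (δC t s - δC t u))
    Q-difference {r} {s} {u} s≢u δCus≈δCsu = begin
      Q r u - Q r s
        ≈⟨ [p-s-u]-[q-s-v]≈[p-q]+[v-u] _ _ _ _ _ ⟩
      (k · δC r u - k · δC r s) + (sumExcept s (λ t → δC t s) - sumExcept u (λ t → δC t u))
        ≈⟨ +-cong (sym (·-distrib-- k _ _)) (∑-zeroAt-diff _ _ s≢u δCus≈δCsu) ⟩
      k · (δC r u - δC r s) + sumExcept₂ s u (λ t → δC t s - δC t u)
        ≈⟨ +-congʳ (sumExcept₂-const s≢u _) ⟨
      sumExcept₂ s u (λ _ → δC r u - δC r s) + sumExcept₂ s u (λ t → δC t s - δC t u)
        ≈⟨ sumExcept₂-+ {r = s} {s = u} (λ _ → δC r u - δC r s) (λ t → δC t s - δC t u) ⟨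
      sumExcept₂ s u (λ t → (δC r u - δC r s) + (δC t s - δC t u)) ∎
      where open ≈-Reasoning

  x-y+[y-x]≈0 : ∀ x y → (x - y) + (y - x) ≈ 0#
  x-y+[y-x]≈0 x y = trans (+-congˡ (sym (⁻¹-anti-homo‿- x y))) (-‿inverseʳ (x - y))

  module _ {n k} (π : Permutation′ n) (δ : Fin n → Fin n → Carrier) (δ-sym : ∀ x y → δ x y ≈ δ y x)
           (kalmanson : Kalmanson (π ⟨$⟩ʳ_) δ) (C : Fin (suc (suc k)) → List (Fin n))
           (ordered : ∀ a b r s → (π ⟨$⟩ʳ a) ∈ C r → (π ⟨$⟩ʳ b) ∈ C s → r Fin.< s → a Fin.< b)
           (μ : Fin n → Carrier) (0≤μ : ∀ x → 0# ≤ μ x) (∑μ≈1 : ∀ r → ∑ (C r) μ ≈ 1#) where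
    open Blocks δ μ C
    open Expectation μ

    δC-four-point : ∀ {r s u t} → Cyclic Fin._<_ r s u t → FourPoint δC r s u t
    δC-four-point {r} {s} {u} {t} cyclic =
      FourPoint-cong (λ x y → sym (δC≈𝔼 δ μ C x y))
        (𝔼-four-point 0≤μ δ (∑μ≈1 r) (∑μ≈1 s) (∑μ≈1 u) (∑μ≈1 t) points-four-point)
      where
      position∈ : ∀ {x r} → x ∈ C r → π ⟨$⟩ʳ (π ⟨$⟩ˡ x) ∈ C r
      position∈ {r = r} = ≡.subst (_∈ C r) (≡.sym (inverseʳ π))

      points-four-point : ∀ {a b c d} → a ∈ C r → b ∈ C s → c ∈ C u → d ∈ C t → FourPoint δ a b c d
      points-four-point a∈ b∈ c∈ d∈ = kalmanson-cyclic kalmanson δ-sym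
        (Cyclic-transport (λ r p → π ⟨$⟩ʳ p ∈ C r) (λ {_} {p} {_} {q} → ordered p q _ _)
           (position∈ a∈) (position∈ b∈) (position∈ c∈) (position∈ d∈) cyclic)
        (inverseʳ π) (inverseʳ π) (inverseʳ π) (inverseʳ π)

    Q-step-nonneg : ∀ i → 0# ≤ (Q i (cyc i 2) - Q i (cyc i 1))
    Q-step-nonneg i =
      ≲-respʳ-≈ (sym (Q-difference δ μ C (cyc-distinct i) (δC-sym δ μ C δ-sym _ _)))
        (sumExcept₂-nonneg _ summand-nonneg)
      where
      summand-nonneg : ∀ t → t ≢ cyc i 1 → t ≢ cyc i 2 →
        0# ≤ ((δC i (cyc i 2) - δC i (cyc i 1)) + (δC t (cyc i 1) - δC t (cyc i 2)))
      summand-nonneg t t≢j t≢l with t Fin.≟ i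
      ... | yes ≡.refl = ≤-reflexive (sym (x-y+[y-x]≈0 _ _))
      ... | no  t≢i    = FourPoint⇒0≤[ac-ab]+[db-dc] (δC-sym δ μ C δ-sym)
                           (δC-four-point (cyc-cyclic i t t≢i t≢j t≢l))

mainTheorem8 : ∀ {c ℓ₁ ℓ₂} (R : OrderedCommRing c ℓ₁ ℓ₂) →
    let open OrderedCommRing R
        open WithRing R
    in
    -- X = {1,…,n}, circular ordering π = (x_1,…,x_n) with x_a = π a
    (n : ℕ) (π : Permutation′ n)
    -- a dissimilarity map satisfying the Kalmanson conditions w.r.t. π
    (δ : Fin n → Fin n → Carrier) → IsDissimilarity δ → Kalmanson (π ⟨$⟩ʳ_) δ →
    -- a partial circular ordering C_1,…,C_m (m ≥ 3): nonempty linearly ordered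
    -- blocks (lists) partitioning X
    (m : ℕ) → 3 ℕ.≤ m → (C : Fin m → List (Fin n)) → (∀ r → C r ≢ []) →
    concat (tabulate C) ↭ allFin n →
    -- a weighting μ
    (μ : Fin n → Carrier) → (∀ x → 0# ≤ μ x) → (∀ r → sumL (map μ (C r)) ≈ 1#) →
    (∀ r x → Endpoint (C r) x → 0# < μ x) →
    -- x_a ∈ C_r, x_b ∈ C_s, r < s  ⇒  a < b
    (∀ a b r s → (π ⟨$⟩ʳ a) ∈ C r → (π ⟨$⟩ʳ b) ∈ C s → r Fin.< s → a Fin.< b) →
    -- Q_δ(C_i, C_{i+2}) − Q_δ(C_i, C_{i+1}) ≥ 0, indices mod m
    (i : Fin m) →
    0# ≤ (Blocks.Q δ μ C i (cyc i 2) - Blocks.Q δ μ C i (cyc i 1))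
-- The blocks need not be nonempty or partition X, and μ need not be positive at the endpoints.
mainTheorem8 R n π δ δ-dissimilarity kalmanson .(suc (suc (suc k))) (s≤s (s≤s (s≤s {n = k} _)))
             C _ _ μ 0≤μ ∑μ≈1 _ ordered =
  Q-step-nonneg R π δ (WithRing.IsDissimilarity.symm δ-dissimilarity) kalmanson C ordered μ 0≤μ ∑μ≈1
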